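{- Let $\mathcal{A}$ be a unital associative algebra over a field of characteristic $0$, let $A\in\operatorname{Mat}(\mathcal{A},n,n)$ and let $I$ be the identity matrix in $\operatorname{Mat}(\mathcal{A},n,n)$ (diagonal entries $1_{\mathcal{A}}$, off-diagonal entries $0$). Then $\mathsf{sdet}(A+I) = \sum_{S\subseteq[n]} \mathsf{sdet}(A_S)$, where $A_S$ is the principal submatrix of $A$ with rows and columns indexed by $S$ (with the convention that the term for $S=\emptyset$ is $1_{\mathcal{A}}$).
   Context: For a $k\times k$ matrix $M=(m_{ij})$ with entries in an associative algebra $\mathcal{A}$ over a field of characteristic $0$, the symmetrized determinant is $\mathsf{sdet}\, M = \frac{1}{k!}\sum_{(\sigma,\tau)\in \mathsf{Sym}_k\times\mathsf{Sym}_k} (\operatorname{sgn}\sigma)(\operatorname{sgn}\tau)\, m_{\sigma(1)\tau(1)} \cdots m_{\sigma(k)\tau(k)}$, products taken in the indicated order. $\operatorname{Mat}(\mathcal{A},n,n)$ denotes the $n\times n$ matrices over $\mathcal{A}$; $1_{\mathcal{A}}$ is the unit of $\mathcal{A}$. -}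

module Defs where

open import Level using (Level; _⊔_) renaming (suc to lsuc)
open import Data.Nat.Base as ℕ using (ℕ; zero; suc; _!; NonZero)
open import Data.Nat.Properties using (_!≢0)
open import Data.Bool.Base using (Bool; true; false; if_then_else_; _∧_; not)
open import Data.Fin.Base using (Fin; _<_)
open import Data.Fin.Properties using (_<?_; _≟_)
open import Data.Fin.Subset using (Subset; inside; outside)
open import Data.List.Base using (List; []; _∷_; [_]; map; concatMap; filter; foldr; length; allFin; lookup; _++_)
open import Data.Bool.ListAction using (and)
open import Data.Bool.Properties using (T?)
open import Data.Vec.Base as Vec using ([]; _∷_)
import Data.Vec.Functional as VF
open import Relation.Nullary using (¬_)
open import Relation.Nullary.Decidable using (⌊_⌋)
open import Algebra.Bundles using (Ring; CommutativeRing)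

record Field (c ℓ : Level) : Set (lsuc (c ⊔ ℓ)) where
  field
    commutativeRing : CommutativeRing c ℓ
  open CommutativeRing commutativeRing public
  field
    0≉1       : ¬ (0# ≈ 1#)
    inv       : (x : Carrier) → ¬ (x ≈ 0#) → Carrier
    inv-inverseʳ : ∀ x (x≉0 : ¬ (x ≈ 0#)) → (x * inv x x≉0) ≈ 1#

module _ {c ℓ : Level} (K : Field c ℓ) where
  open Field K

  fromℕ : ℕ → Carrier
  fromℕ zero    = 0#
  fromℕ (suc n) = 1# + fromℕ n

  CharZero : Set ℓ
  CharZero = ∀ (n : ℕ) → .{{NonZero n}} → ¬ (fromℕ n ≈ 0#)

record Algebra {c ℓ : Level} (K : Field c ℓ) (a ℓa : Level) : Set (c ⊔ ℓ ⊔ lsuc (a ⊔ ℓa)) where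
  module K = Field K
  field
    ring : Ring a ℓa
  open Ring ring public
  field
    _·_     : K.Carrier → Carrier → Carrier
    ·-cong  : ∀ {λ₁ λ₂ x y} → λ₁ K.≈ λ₂ → x ≈ y → (λ₁ · x) ≈ (λ₂ · y)
    ·-distribʳ : ∀ λ₁ λ₂ x → ((λ₁ K.+ λ₂) · x) ≈ ((λ₁ · x) + (λ₂ · x))
    ·-distribˡ : ∀ λ₁ x y → (λ₁ · (x + y)) ≈ ((λ₁ · x) + (λ₁ · y))
    ·-assoc : ∀ λ₁ λ₂ x → ((λ₁ K.* λ₂) · x) ≈ (λ₁ · (λ₂ · x))
    ·-identity : ∀ x → (K.1# · x) ≈ x
    ·-*-assocˡ : ∀ λ₁ x y → ((λ₁ · x) * y) ≈ (λ₁ · (x * y))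
    ·-*-assocʳ : ∀ λ₁ x y → (x * (λ₁ · y)) ≈ (λ₁ · (x * y))

allFuns : (k m : ℕ) → List (Fin k → Fin m)
allFuns zero    m = [ (λ ()) ]
allFuns (suc k) m = concatMap (λ i → map (λ f → i VF.∷ f) (allFuns k m)) (allFin m)

pairsTest : {k : ℕ} → (Fin k → Fin k → Bool) → List Bool
pairsTest {k} t = concatMap (λ i → concatMap (λ j → if ⌊ i <? j ⌋ then [ t i j ] else []) (allFin k)) (allFin k)

isPerm : {k : ℕ} → (Fin k → Fin k) → Bool
isPerm f = and (pairsTest (λ i j → not ⌊ f i ≟ f j ⌋))

Sym : (k : ℕ) → List (Fin k → Fin k)
Sym k = filter (λ f → T? (isPerm f)) (allFuns k k)

inversions : {k : ℕ} → (Fin k → Fin k) → ℕ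
inversions σ = length (filter (λ b → T? b) (pairsTest (λ i j → ⌊ σ j <? σ i ⌋)))

isEven : ℕ → Bool
isEven zero    = true
isEven (suc n) = not (isEven n)

allSubsets : (n : ℕ) → List (Subset n)
allSubsets zero    = [ [] ]
allSubsets (suc n) = map (inside ∷_) (allSubsets n) ++ map (outside ∷_) (allSubsets n)

elems : {n : ℕ} → Subset n → List (Fin n)
elems {n} S = filter (λ i → T? (Vec.lookup S i)) (allFin n)

module SDet {c ℓ a ℓa : Level} (K : Field c ℓ) (cz : CharZero K) (𝒜 : Algebra K a ℓa) where
  open Algebra 𝒜

  Mat : ℕ → Set a
  Mat n = Fin n → Fin n → Carrier

  Σ : {X : Set} → List X → (X → Carrier) → Carrier
  Σ xs f = foldr (λ x s → f x + s) 0# xs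

  Π : (k : ℕ) → (Fin k → Carrier) → Carrier
  Π k f = foldr (λ i p → f i * p) 1# (allFin k)

  sgn : {k : ℕ} → (Fin k → Fin k) → Carrier
  sgn σ = if isEven (inversions σ) then 1# else (- 1#)

  invFact : ℕ → K.Carrier
  invFact k = K.inv (fromℕ K (k !)) (cz (k !) {{k !≢0}})

  sdet : {k : ℕ} → Mat k → Carrier
  sdet {k} M = invFact k · Σ (Sym k) (λ σ → Σ (Sym k) (λ τ →
                 (sgn σ * sgn τ) * Π k (λ i → M (σ i) (τ i))))

  I : {n : ℕ} → Mat n
  I i j = if ⌊ i ≟ j ⌋ then 1# else 0#

  _+ᴹ_ : {n : ℕ} → Mat n → Mat n → Mat n
  (M +ᴹ N) i j = M i j + N i j

  principal : {n : ℕ} → Mat n → (S : Subset n) → Mat (length (elems S))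
  principal M S i j = M (lookup (elems S) i) (lookup (elems S) j)

{-# OPTIONS --safe #-}
module Submission where

-- Write Sdet M = k! · sdet M for a k × k matrix M. Splitting off the first factor of every
-- product in the double sum over pairs of permutations gives the recursion
--   Sdet M = Σᵢⱼ (-1)^(i+j) Mᵢⱼ Sdet (Mⁱʲ),   Mⁱʲ the minor deleting row i and column j.
-- Every product in Sdet M contains exactly one entry from each row, so Sdet is additive in
-- each row, and expanding all rows of A + I gives Sdet (A + I) = Σ_S Sdet (select S A I),
-- the matrix taking its rows in S from A and the others from I. If row r of a (k+1) × (k+1)
-- matrix M is the unit row e_c, then Sdet M = (k+1) (-1)^(r+c) Sdet (Mʳᶜ): in the recursion
-- the terms with i = r give this once, and by induction on the minors, which keep a unit
-- row, each of the k other rows gives it once more. Deleting the n − |S| unit rows of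
-- select S A I one at a time yields |S|! · Sdet (select S A I) = n! · Sdet (A_S); since K has
-- characteristic 0 we may divide by n!, which turns the expansion of Sdet (A + I) into the
-- theorem.

open import Defs
open import Level using (Level; 0ℓ)
open import Algebra.Bundles using (Monoid; CommutativeMonoid; Ring)
open import Data.Bool.Base using (Bool; true; false; if_then_else_; not; _∧_; _xor_; T)
open import Data.Bool.ListAction using (and)
open import Data.Bool.Properties
  using ( T?; T-∧; if-∧; not-involutive; not-distribˡ-xor; not-distribʳ-xor; xor-annihilates-not
        ; xor-identityʳ; xor-same)
open import Data.Empty using (⊥-elim)
open import Data.Fin.Base using (Fin; zero; suc; punchIn; punchOut; toℕ; cast)
open import Data.Fin.Properties
  using (_<?_; _≟_; all?; ¬∀⟶∃¬; cast-is-id; punchIn-injective; punchInᵢ≢i; punchIn-punchOut)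
open import Data.Fin.Subset using (Subset; inside; outside)
open import Data.List.Base
  using (List; []; _∷_; [_]; _++_; concat; concatMap; filter; foldr; length; lookup; map; tabulate; allFin)
open import Data.List.Properties
  using ( filter-++; filter-all; filter-reject; filter-≐; length-++; length-map; length-tabulate
        ; lookup-tabulate; map-tabulate; tabulate-cong)
open import Data.List.Relation.Unary.All.Properties using (tabulate⁺)
open import Data.Nat.Base as ℕ using (ℕ; zero; suc; _!; s<s; s<s⁻¹)
import Data.Nat.Properties as ℕₚ
open import Data.Product using (Σ-syntax; _,_; proj₁; proj₂)
open import Data.Vec.Base as Vec using ([]; _∷_)
import Data.Vec.Functional as VF
open import Data.Vec.Functional.Properties using (updateAt-updates; updateAt-minimal)
open import Function.Base using (_∘_; id; const)
open import Function.Bundles using (_⇔_; mk⇔; Equivalence)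
open import Relation.Binary.Core using (_Preserves_⟶_)
import Relation.Binary.PropositionalEquality as ≡
open ≡ using (_≡_; _≢_; _≗_; module ≡-Reasoning)
open import Relation.Nullary using (Dec; ¬_; yes; no; does)
open import Relation.Nullary.Decidable using (⌊_⌋; isYes≗does; does-⇔; dec-true; dec-false)
open import Relation.Unary using (Pred; Decidable; _≐_)

private variable
  k m n : ℕ

⌊⌋-⇔ : {a b : Level} {A : Set a} {B : Set b} → A ⇔ B → (a? : Dec A) (b? : Dec B) → ⌊ a? ⌋ ≡ ⌊ b? ⌋
⌊⌋-⇔ A⇔B a? b? = ≡.trans (isYes≗does a?) (≡.trans (does-⇔ A⇔B a? b?) (≡.sym (isYes≗does b?)))

<?-suc : (i j : Fin k) → ⌊ suc i <? suc j ⌋ ≡ ⌊ i <? j ⌋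
<?-suc i j = ⌊⌋-⇔ (mk⇔ s<s⁻¹ s<s) (suc i <? suc j) (i <? j)

<?-punchIn : (x : Fin (suc m)) (a b : Fin m) → ⌊ punchIn x a <? punchIn x b ⌋ ≡ ⌊ a <? b ⌋
<?-punchIn zero    a       b       = <?-suc a b
<?-punchIn (suc x) zero    zero    = ≡.refl
<?-punchIn (suc x) zero    (suc b) = ≡.refl
<?-punchIn (suc x) (suc a) zero    = ≡.refl
<?-punchIn (suc x) (suc a) (suc b) =
  ≡.trans (<?-suc (punchIn x a) (punchIn x b)) (≡.trans (<?-punchIn x a b) (≡.sym (<?-suc a b)))

≟-punchIn : (x : Fin (suc m)) (a b : Fin m) → ⌊ punchIn x a ≟ punchIn x b ⌋ ≡ ⌊ a ≟ b ⌋
≟-punchIn x a b =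
  ⌊⌋-⇔ (mk⇔ (punchIn-injective x a b) (≡.cong (punchIn x))) (punchIn x a ≟ punchIn x b) (a ≟ b)

≟-≡ : {x y : Fin m} → x ≡ y → ⌊ x ≟ y ⌋ ≡ true
≟-≡ {x = x} {y} x≡y = ≡.trans (isYes≗does (x ≟ y)) (dec-true (x ≟ y) x≡y)

≟-≢ : {x y : Fin m} → x ≢ y → ⌊ x ≟ y ⌋ ≡ false
≟-≢ {x = x} {y} x≢y = ≡.trans (isYes≗does (x ≟ y)) (dec-false (x ≟ y) x≢y)

pairsTest-suc : (t : Fin (suc k) → Fin (suc k) → Bool) →
  pairsTest t ≡ tabulate (λ j → t zero (suc j)) ++ pairsTest (λ i j → t (suc i) (suc j))
pairsTest-suc {k} t = ≡.cong₂ _++_ firstRow laterRows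
  where
  open ≡-Reasoning
  concatMap-tabulate : {A B : Set} {n : ℕ} (f : A → List B) (g : Fin n → A) →
    concatMap f (tabulate g) ≡ concat (tabulate (f ∘ g))
  concatMap-tabulate f g = ≡.cong concat (map-tabulate g f)
  singletons : {A : Set} {n : ℕ} (h : Fin n → A) → concat (tabulate (λ j → [ h j ])) ≡ tabulate h
  singletons {n = zero}  h = ≡.refl
  singletons {n = suc n} h = ≡.cong (h zero ∷_) (singletons (h ∘ suc))
  row : {n : ℕ} → (Fin n → Fin n → Bool) → Fin n → Fin n → List Bool
  row u i j = if ⌊ i <? j ⌋ then [ u i j ] else []
  t′ : Fin k → Fin k → Bool
  t′ i j = t (suc i) (suc j)
  firstRow : concatMap (row t zero) (tabulate suc) ≡ tabulate (λ j → t zero (suc j))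
  firstRow = ≡.trans (concatMap-tabulate (row t zero) suc) (singletons (λ j → t zero (suc j)))
  laterRows : concatMap (λ i → concatMap (row t i) (allFin (suc k))) (tabulate suc) ≡ pairsTest t′
  laterRows = begin
    concatMap (λ i → concatMap (row t i) (allFin (suc k))) (tabulate suc)
      ≡⟨ concatMap-tabulate (λ i → concatMap (row t i) (allFin (suc k))) suc ⟩
    concat (tabulate (λ i → concatMap (row t (suc i)) (tabulate suc)))
      ≡⟨ ≡.cong concat (tabulate-cong (λ i → concatMap-tabulate (row t (suc i)) suc)) ⟩
    concat (tabulate (λ i → concat (tabulate (λ j → row t (suc i) (suc j)))))
      ≡⟨ ≡.cong concat (tabulate-cong (λ i → ≡.cong concat (tabulate-cong (λ j →
           ≡.cong (λ b → if b then [ t′ i j ] else []) (<?-suc i j))))) ⟩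
    concat (tabulate (λ i → concat (tabulate (row t′ i))))
      ≡⟨ ≡.cong concat (tabulate-cong (λ i → concatMap-tabulate (row t′ i) id)) ⟨
    concat (tabulate (λ i → concatMap (row t′ i) (allFin k)))
      ≡⟨ concatMap-tabulate (λ i → concatMap (row t′ i) (allFin k)) id ⟨
    pairsTest t′ ∎

pairsTest-cong : {t u : Fin k → Fin k → Bool} → (∀ i j → t i j ≡ u i j) → pairsTest t ≡ pairsTest u
pairsTest-cong {zero}  t≡u = ≡.refl
pairsTest-cong {suc k} {t} {u} t≡u = begin
  pairsTest t                                                               ≡⟨ pairsTest-suc t ⟩
  tabulate (λ j → t zero (suc j)) ++ pairsTest (λ i j → t (suc i) (suc j))
    ≡⟨ ≡.cong₂ _++_ (tabulate-cong (λ j → t≡u zero (suc j))) (pairsTest-cong (λ i j → t≡u (suc i) (suc j))) ⟩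
  tabulate (λ j → u zero (suc j)) ++ pairsTest (λ i j → u (suc i) (suc j)) ≡⟨ pairsTest-suc u ⟨
  pairsTest u                                                               ∎
  where open ≡-Reasoning

and-++ : (xs ys : List Bool) → and (xs ++ ys) ≡ and xs ∧ and ys
and-++ []           ys = ≡.refl
and-++ (true ∷ xs)  ys = and-++ xs ys
and-++ (false ∷ xs) ys = ≡.refl

isInjection : (Fin k → Fin m) → Bool
isInjection f = and (pairsTest (λ i j → not ⌊ f i ≟ f j ⌋))

-- Sym k is injections k k, definitionally.
injections : (k m : ℕ) → List (Fin k → Fin m)
injections k m = filter (T? ∘ isInjection) (allFuns k m)

avoids : Fin m → (Fin k → Fin m) → Bool
avoids x f = and (tabulate (λ j → not ⌊ x ≟ f j ⌋))

isInjection-suc : (f : Fin (suc k) → Fin m) →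
  isInjection f ≡ avoids (f zero) (f ∘ suc) ∧ isInjection (f ∘ suc)
isInjection-suc f = ≡.trans (≡.cong and (pairsTest-suc (λ i j → not ⌊ f i ≟ f j ⌋)))
  (and-++ (tabulate (λ j → not ⌊ f zero ≟ f (suc j) ⌋)) (pairsTest (λ i j → not ⌊ f (suc i) ≟ f (suc j) ⌋)))

isInjection⇒avoids-head : (f : Fin (suc k) → Fin m) → T (isInjection f) → T (avoids (f zero) (f ∘ suc))
isInjection⇒avoids-head f f-inj = proj₁ (Equivalence.to T-∧ (≡.subst T (isInjection-suc f) f-inj))

isInjection⇒tail : (f : Fin (suc k) → Fin m) → T (isInjection f) → T (isInjection (f ∘ suc))
isInjection⇒tail f f-inj = proj₂ (Equivalence.to T-∧ (≡.subst T (isInjection-suc f) f-inj))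

isInjection-cong : {f g : Fin k → Fin m} → f ≗ g → isInjection f ≡ isInjection g
isInjection-cong f≗g =
  ≡.cong and (pairsTest-cong (λ i j → ≡.cong₂ (λ a b → not ⌊ a ≟ b ⌋) (f≗g i) (f≗g j)))

isInjection-punchIn : (x : Fin (suc m)) (g : Fin k → Fin m) → isInjection (punchIn x ∘ g) ≡ isInjection g
isInjection-punchIn x g = ≡.cong and (pairsTest-cong (λ i j → ≡.cong not (≟-punchIn x (g i) (g j))))

avoids⇒≢ : {x : Fin m} {f : Fin k → Fin m} → T (avoids x f) → ∀ j → x ≢ f j
avoids⇒≢ {k = suc k} x∉f zero x≡f0 = ≡.subst T (≡.cong not (≟-≡ x≡f0)) (proj₁ (Equivalence.to T-∧ x∉f))
avoids⇒≢ {k = suc k} x∉f (suc j)   = avoids⇒≢ (proj₂ (Equivalence.to T-∧ x∉f)) j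

avoids⇒punchIn : {x : Fin (suc m)} {f : Fin k → Fin (suc m)} → T (avoids x f) →
  Σ[ g ∈ (Fin k → Fin m) ] f ≗ punchIn x ∘ g
avoids⇒punchIn x∉f =
  (λ j → punchOut (avoids⇒≢ x∉f j)) , (λ j → ≡.sym (punchIn-punchOut (avoids⇒≢ x∉f j)))

∷-congʳ : {a : Level} {A : Set a} (v : A) {f g : Fin n → A} → f ≗ g → (v VF.∷ f) ≗ (v VF.∷ g)
∷-congʳ v f≗g zero    = ≡.refl
∷-congʳ v f≗g (suc i) = f≗g i

select : {a : Level} {A : Set a} → Subset n → (Fin n → A) → (Fin n → A) → Fin n → A
select S l r i = if Vec.lookup S i then l i else r i

module _ {a : Level} {A : Set a} (S : Subset n) {l r : Fin n → A} {i : Fin n} where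

  select-∈ : T (Vec.lookup S i) → select S l r i ≡ l i
  select-∈ i∈S with Vec.lookup S i
  ... | true = ≡.refl

  select-∉ : ¬ T (Vec.lookup S i) → select S l r i ≡ r i
  select-∉ i∉S with Vec.lookup S i
  ... | true  = ⊥-elim (i∉S _)
  ... | false = ≡.refl

module MonoidSums {c ℓ : Level} (M : Monoid c ℓ) where
  open Monoid M
    renaming (_∙_ to _+_; ε to 0#; identityˡ to +-identityˡ; ∙-cong to +-cong; ∙-congˡ to +-congˡ; assoc to +-assoc)
  open import Algebra.Properties.Monoid.Sum M using (sum; sum-syntax)

  ∑ˡ : {X : Set} → List X → (X → Carrier) → Carrier
  ∑ˡ xs f = foldr (λ x s → f x + s) 0# xs

  infixl 10 ∑ˡ
  syntax ∑ˡ xs (λ x → e) = ∑[ x ∈ xs ] e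

  private variable
    X Y : Set

  ∑ˡ-cong : (xs : List X) {f g : X → Carrier} → (∀ x → f x ≈ g x) → ∑ˡ xs f ≈ ∑ˡ xs g
  ∑ˡ-cong []       f≈g = refl
  ∑ˡ-cong (x ∷ xs) f≈g = +-cong (f≈g x) (∑ˡ-cong xs f≈g)

  ∑ˡ-zero : (xs : List X) {f : X → Carrier} → (∀ x → f x ≈ 0#) → ∑ˡ xs f ≈ 0#
  ∑ˡ-zero []       f≈0 = refl
  ∑ˡ-zero (x ∷ xs) f≈0 = trans (+-cong (f≈0 x) (∑ˡ-zero xs f≈0)) (+-identityˡ 0#)

  ∑ˡ-++ : (xs ys : List X) (f : X → Carrier) → ∑ˡ (xs ++ ys) f ≈ ∑ˡ xs f + ∑ˡ ys f
  ∑ˡ-++ []       ys f = sym (+-identityˡ _)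
  ∑ˡ-++ (x ∷ xs) ys f = trans (+-congˡ (∑ˡ-++ xs ys f)) (sym (+-assoc _ _ _))

  ∑ˡ-map : (g : X → Y) (xs : List X) (f : Y → Carrier) → ∑ˡ (map g xs) f ≡ ∑ˡ xs (f ∘ g)
  ∑ˡ-map g []       f = ≡.refl
  ∑ˡ-map g (x ∷ xs) f = ≡.cong (f (g x) +_) (∑ˡ-map g xs f)

  ∑ˡ-concatMap : (g : X → List Y) (xs : List X) (f : Y → Carrier) →
    ∑ˡ (concatMap g xs) f ≈ ∑[ x ∈ xs ] ∑ˡ (g x) f
  ∑ˡ-concatMap g []       f = refl
  ∑ˡ-concatMap g (x ∷ xs) f = trans (∑ˡ-++ (g x) (concatMap g xs) f) (+-congˡ (∑ˡ-concatMap g xs f))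

  ∑ˡ-tabulate : (g : Fin n → X) (f : X → Carrier) → ∑ˡ (tabulate g) f ≡ sum (f ∘ g)
  ∑ˡ-tabulate {n = zero}  g f = ≡.refl
  ∑ˡ-tabulate {n = suc n} g f = ≡.cong (f (g zero) +_) (∑ˡ-tabulate (g ∘ suc) f)

  ∑ˡ-filter : (p : X → Bool) (xs : List X) (f : X → Carrier) →
    ∑ˡ (filter (T? ∘ p) xs) f ≈ ∑[ x ∈ xs ] (if p x then f x else 0#)
  ∑ˡ-filter p []       f = refl
  ∑ˡ-filter p (x ∷ xs) f with p x
  ... | true  = +-congˡ (∑ˡ-filter p xs f)
  ... | false = trans (∑ˡ-filter p xs f) (sym (+-identityˡ _))

  ∑ˡ-filter-cong : (p : X → Bool) (xs : List X) {f g : X → Carrier} → (∀ x → T (p x) → f x ≈ g x) →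
    ∑ˡ (filter (T? ∘ p) xs) f ≈ ∑ˡ (filter (T? ∘ p) xs) g
  ∑ˡ-filter-cong p []       f≈g = refl
  ∑ˡ-filter-cong p (x ∷ xs) f≈g with p x | f≈g x
  ... | true  | fx≈gx = +-cong (fx≈gx _) (∑ˡ-filter-cong p xs f≈g)
  ... | false | _     = ∑ˡ-filter-cong p xs f≈g

  ∑ˡ-homo : (h : Carrier → Carrier) → (∀ {x y} → x ≈ y → h x ≈ h y) → h 0# ≈ 0# →
    (∀ x y → h (x + y) ≈ h x + h y) → (xs : List X) (f : X → Carrier) →
    ∑[ x ∈ xs ] h (f x) ≈ h (∑ˡ xs f)
  ∑ˡ-homo h h-cong h-0 h-+ []       f = sym h-0
  ∑ˡ-homo h h-cong h-0 h-+ (x ∷ xs) f = trans (+-congˡ (∑ˡ-homo h h-cong h-0 h-+ xs f)) (sym (h-+ _ _))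

  ∑-homo : (h : Carrier → Carrier) → (∀ {x y} → x ≈ y → h x ≈ h y) → h 0# ≈ 0# →
    (∀ x y → h (x + y) ≈ h x + h y) → (f : Fin n → Carrier) → ∑[ i < n ] h (f i) ≈ h (sum f)
  ∑-homo {n = zero}  h h-cong h-0 h-+ f = sym h-0
  ∑-homo {n = suc n} h h-cong h-0 h-+ f = trans (+-congˡ (∑-homo h h-cong h-0 h-+ (f ∘ suc))) (sym (h-+ _ _))

  if-cong : (b : Bool) {x y : Carrier} → x ≈ y → (if b then x else 0#) ≈ (if b then y else 0#)
  if-cong true  x≈y = x≈y
  if-cong false x≈y = refl

  ∑ˡ-if : (b : Bool) (xs : List X) (f : X → Carrier) →
    ∑[ x ∈ xs ] (if b then f x else 0#) ≈ (if b then ∑ˡ xs f else 0#)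
  ∑ˡ-if true  xs f = refl
  ∑ˡ-if false xs f = ∑ˡ-zero xs (λ _ → refl)

module CommutativeMonoidSums {c ℓ : Level} (M : CommutativeMonoid c ℓ) where
  open CommutativeMonoid M
    renaming ( _∙_ to _+_; ε to 0#; identityˡ to +-identityˡ; identityʳ to +-identityʳ
             ; ∙-cong to +-cong; ∙-congˡ to +-congˡ; ∙-congʳ to +-congʳ)
  open MonoidSums monoid public
  open import Algebra.Properties.CommutativeMonoid.Sum M public
    using (sum; sum-syntax; sum-remove; ∑-distrib-+; sum-cong-≋; sum-cong-≗; sum-replicate-zero)
  open import Algebra.Properties.CommutativeSemigroup commutativeSemigroup using (interchange)
  open import Relation.Binary.Reasoning.Setoid setoid

  private variable
    X : Set

  ∑ˡ-distrib : (xs : List X) (f g : X → Carrier) → ∑[ x ∈ xs ] (f x + g x) ≈ ∑ˡ xs f + ∑ˡ xs g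
  ∑ˡ-distrib []       f g = sym (+-identityˡ 0#)
  ∑ˡ-distrib (x ∷ xs) f g = trans (+-congˡ (∑ˡ-distrib xs f g)) (interchange _ _ _ _)

  ∑ˡ-∑-comm : (xs : List X) (f : X → Fin n → Carrier) →
    ∑[ x ∈ xs ] ∑[ i < n ] f x i ≈ ∑[ i < n ] ∑[ x ∈ xs ] f x i
  ∑ˡ-∑-comm {n = n} []       f = sym (sum-replicate-zero n)
  ∑ˡ-∑-comm         (x ∷ xs) f = trans (+-congˡ (∑ˡ-∑-comm xs f)) (sym (∑-distrib-+ (f x) _))

  ∑-injection : (ρ : Fin k → Fin k) → T (isInjection ρ) → (f : Fin k → Carrier) → ∑[ i < k ] f (ρ i) ≈ sum f
  ∑-injection {zero}  ρ ρ-inj f = refl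
  ∑-injection {suc k} ρ ρ-inj f with avoids⇒punchIn (isInjection⇒avoids-head ρ ρ-inj)
  ... | g , ρ∘suc≗ = begin
    f x + ∑[ i < k ] f (ρ (suc i))       ≡⟨ ≡.cong (f x +_) (sum-cong-≗ (≡.cong f ∘ ρ∘suc≗)) ⟩
    f x + ∑[ i < k ] f (punchIn x (g i)) ≈⟨ +-congˡ (∑-injection g g-inj (f ∘ punchIn x)) ⟩
    f x + ∑[ i < k ] f (punchIn x i)     ≈⟨ sum-remove {i = x} f ⟨
    sum f                                ∎
    where
    x = ρ zero
    g-inj : T (isInjection g)
    g-inj = ≡.subst T (≡.trans (isInjection-cong ρ∘suc≗) (isInjection-punchIn x g)) (isInjection⇒tail ρ ρ-inj)

  ∑ˡ-allFuns-suc : (F : (Fin (suc k) → Fin m) → Carrier) →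
    ∑ˡ (allFuns (suc k) m) F ≈ ∑[ v < m ] ∑[ g ∈ allFuns k m ] F (v VF.∷ g)
  ∑ˡ-allFuns-suc {k} {m} F = begin
    ∑ˡ (allFuns (suc k) m) F
      ≈⟨ ∑ˡ-concatMap (λ v → map (v VF.∷_) (allFuns k m)) (allFin m) F ⟩
    ∑[ v ∈ allFin m ] ∑ˡ (map (v VF.∷_) (allFuns k m)) F
      ≡⟨ ∑ˡ-tabulate id (λ v → ∑ˡ (map (v VF.∷_) (allFuns k m)) F) ⟩
    ∑[ v < m ] ∑ˡ (map (v VF.∷_) (allFuns k m)) F
      ≡⟨ sum-cong-≗ (λ v → ∑ˡ-map (v VF.∷_) (allFuns k m) F) ⟩
    ∑[ v < m ] ∑[ g ∈ allFuns k m ] F (v VF.∷ g) ∎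

  ∑ˡ-allFuns-avoiding : (x : Fin (suc m)) (H : (Fin k → Fin (suc m)) → Carrier) → H Preserves _≗_ ⟶ _≈_ →
    ∑[ f ∈ allFuns k (suc m) ] (if avoids x f then H f else 0#) ≈ ∑[ g ∈ allFuns k m ] H (punchIn x ∘ g)
  ∑ˡ-allFuns-avoiding {k = zero}      x H H-cong = +-congʳ (H-cong (λ ()))
  ∑ˡ-allFuns-avoiding {m} {k = suc k} x H H-cong = begin
    ∑[ f ∈ allFuns (suc k) (suc m) ] (if avoids x f then H f else 0#)
      ≈⟨ ∑ˡ-allFuns-suc (λ f → if avoids x f then H f else 0#) ⟩
    ∑[ v < suc m ] ∑[ f ∈ Fs ] (if not ⌊ x ≟ v ⌋ ∧ avoids x f then H (v VF.∷ f) else 0#)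
      ≈⟨ sum-cong-≋ (λ v → trans
           (∑ˡ-cong Fs (λ f → reflexive (if-∧ (not ⌊ x ≟ v ⌋) {avoids x f} {H (v VF.∷ f)} {0#})))
           (∑ˡ-if (not ⌊ x ≟ v ⌋) Fs (λ f → if avoids x f then H (v VF.∷ f) else 0#))) ⟩
    ∑[ v < suc m ] (if not ⌊ x ≟ v ⌋ then ∑[ f ∈ Fs ] (if avoids x f then H (v VF.∷ f) else 0#) else 0#)
      ≈⟨ sum-cong-≋ (λ v → if-cong (not ⌊ x ≟ v ⌋)
                                   (∑ˡ-allFuns-avoiding x (H ∘ (v VF.∷_)) (H-cong ∘ ∷-congʳ v))) ⟩
    ∑[ v < suc m ] (if not ⌊ x ≟ v ⌋ then G v else 0#)
      ≈⟨ sum-remove {i = x} (λ v → if not ⌊ x ≟ v ⌋ then G v else 0#) ⟩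
    (if not ⌊ x ≟ x ⌋ then G x else 0#) + ∑[ u < m ] (if not ⌊ x ≟ punchIn x u ⌋ then G (punchIn x u) else 0#)
      ≡⟨ ≡.cong₂ _+_ (≡.cong (λ b → if not b then G x else 0#) (≟-≡ ≡.refl))
                     (sum-cong-≗ (λ u → ≡.cong (λ b → if not b then G (punchIn x u) else 0#)
                                               (≟-≢ (punchInᵢ≢i x u ∘ ≡.sym)))) ⟩
    0# + ∑[ u < m ] G (punchIn x u)
      ≈⟨ +-identityˡ _ ⟩
    ∑[ u < m ] ∑[ g ∈ allFuns k m ] H (punchIn x u VF.∷ punchIn x ∘ g)
      ≈⟨ sum-cong-≋ (λ u → ∑ˡ-cong (allFuns k m) (λ g → H-cong (punchIn-∷ u g))) ⟨
    ∑[ u < m ] ∑[ g ∈ allFuns k m ] H (punchIn x ∘ (u VF.∷ g))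
      ≈⟨ ∑ˡ-allFuns-suc (λ g → H (punchIn x ∘ g)) ⟨
    ∑[ g ∈ allFuns (suc k) m ] H (punchIn x ∘ g) ∎
    where
    Fs = allFuns k (suc m)
    G : Fin (suc m) → Carrier
    G v = ∑[ g ∈ allFuns k m ] H (v VF.∷ punchIn x ∘ g)
    punchIn-∷ : (u : Fin m) (g : Fin k → Fin m) → punchIn x ∘ (u VF.∷ g) ≗ (punchIn x u VF.∷ punchIn x ∘ g)
    punchIn-∷ u g zero    = ≡.refl
    punchIn-∷ u g (suc i) = ≡.refl

  ∑ˡ-injections-suc : (F : (Fin (suc k) → Fin (suc m)) → Carrier) → F Preserves _≗_ ⟶ _≈_ →
    ∑ˡ (injections (suc k) (suc m)) F ≈ ∑[ x < suc m ] ∑[ g ∈ injections k m ] F (x VF.∷ punchIn x ∘ g)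
  ∑ˡ-injections-suc {k} {m} F F-cong = begin
    ∑ˡ (injections (suc k) (suc m)) F
      ≈⟨ ∑ˡ-filter isInjection (allFuns (suc k) (suc m)) F ⟩
    ∑[ f ∈ allFuns (suc k) (suc m) ] (if isInjection f then F f else 0#)
      ≈⟨ ∑ˡ-allFuns-suc (λ f → if isInjection f then F f else 0#) ⟩
    ∑[ x < suc m ] ∑[ f ∈ allFuns k (suc m) ] (if isInjection (x VF.∷ f) then F (x VF.∷ f) else 0#)
      ≈⟨ sum-cong-≋ (λ x → ∑ˡ-cong (allFuns k (suc m)) (λ f → reflexive (≡.trans
           (≡.cong (λ b → if b then F (x VF.∷ f) else 0#) (isInjection-suc (x VF.∷ f)))
           (if-∧ (avoids x f) {isInjection f} {F (x VF.∷ f)} {0#})))) ⟩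
    ∑[ x < suc m ] ∑[ f ∈ allFuns k (suc m) ] (if avoids x f then H x f else 0#)
      ≈⟨ sum-cong-≋ (λ x → ∑ˡ-allFuns-avoiding x (H x) (H-cong x)) ⟩
    ∑[ x < suc m ] ∑[ g ∈ allFuns k m ] H x (punchIn x ∘ g)
      ≈⟨ sum-cong-≋ (λ x → ∑ˡ-cong (allFuns k m) (λ g → reflexive
           (≡.cong (λ b → if b then F (x VF.∷ punchIn x ∘ g) else 0#) (isInjection-punchIn x g)))) ⟩
    ∑[ x < suc m ] ∑[ g ∈ allFuns k m ] (if isInjection g then F (x VF.∷ punchIn x ∘ g) else 0#)
      ≈⟨ sum-cong-≋ (λ x → ∑ˡ-filter isInjection (allFuns k m) (λ g → F (x VF.∷ punchIn x ∘ g))) ⟨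
    ∑[ x < suc m ] ∑[ g ∈ injections k m ] F (x VF.∷ punchIn x ∘ g) ∎
    where
    H : Fin (suc m) → (Fin k → Fin (suc m)) → Carrier
    H x f = if isInjection f then F (x VF.∷ f) else 0#
    H-cong : ∀ x → H x Preserves _≗_ ⟶ _≈_
    H-cong x {f} {g} f≗g =
      trans (reflexive (≡.cong (λ b → if b then F (x VF.∷ f) else 0#) (isInjection-cong f≗g)))
            (if-cong (isInjection g) (F-cong (∷-congʳ x f≗g)))

  ∑ˡ-allSubsets : {a : Level} {A : Set a} (l r l+r : Fin n → A) (Φ : (Fin n → A) → Carrier) →
    Φ Preserves _≗_ ⟶ _≈_ →
    (∀ μ i → Φ (VF.updateAt μ i (const (l+r i)))
           ≈ Φ (VF.updateAt μ i (const (l i))) + Φ (VF.updateAt μ i (const (r i)))) →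
    ∑[ S ∈ allSubsets n ] Φ (select S l r) ≈ Φ l+r
  ∑ˡ-allSubsets {zero}  l r l+r Φ Φ-cong Φ-additive = trans (+-identityʳ _) (Φ-cong (λ ()))
  ∑ˡ-allSubsets {suc n} l r l+r Φ Φ-cong Φ-additive = begin
    ∑ˡ (map (inside ∷_) Ss ++ map (outside ∷_) Ss) (Φ ∘ choose)
      ≈⟨ ∑ˡ-++ (map (inside ∷_) Ss) (map (outside ∷_) Ss) (Φ ∘ choose) ⟩
    ∑ˡ (map (inside ∷_) Ss) (Φ ∘ choose) + ∑ˡ (map (outside ∷_) Ss) (Φ ∘ choose)
      ≡⟨ ≡.cong₂ _+_ (∑ˡ-map (inside ∷_) Ss (Φ ∘ choose)) (∑ˡ-map (outside ∷_) Ss (Φ ∘ choose)) ⟩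
    ∑[ S ∈ Ss ] Φ (choose (inside ∷ S)) + ∑[ S ∈ Ss ] Φ (choose (outside ∷ S))
      ≈⟨ ∑ˡ-distrib Ss (Φ ∘ choose ∘ (inside ∷_)) (Φ ∘ choose ∘ (outside ∷_)) ⟨
    ∑[ S ∈ Ss ] (Φ (choose (inside ∷ S)) + Φ (choose (outside ∷ S)))
      ≈⟨ ∑ˡ-cong Ss split ⟨
    ∑[ S ∈ Ss ] Φ′ (select S (l ∘ suc) (r ∘ suc))
      ≈⟨ ∑ˡ-allSubsets (l ∘ suc) (r ∘ suc) (l+r ∘ suc) Φ′ (Φ-cong ∘ ∷-congʳ (l+r zero)) Φ′-additive ⟩
    Φ′ (l+r ∘ suc)
      ≈⟨ Φ-cong (λ { zero → ≡.refl ; (suc i) → ≡.refl }) ⟩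
    Φ l+r ∎
    where
    Ss = allSubsets n
    choose : Subset (suc n) → Fin (suc n) → _
    choose S = select S l r
    Φ′ : (Fin n → _) → Carrier
    Φ′ μ = Φ (l+r zero VF.∷ μ)
    split : ∀ S → Φ′ (select S (l ∘ suc) (r ∘ suc)) ≈ Φ (choose (inside ∷ S)) + Φ (choose (outside ∷ S))
    split S = trans (Φ-cong (λ { zero → ≡.refl ; (suc i) → ≡.refl }))
      (trans (Φ-additive (l+r zero VF.∷ select S (l ∘ suc) (r ∘ suc)) zero)
             (+-cong (Φ-cong (λ { zero → ≡.refl ; (suc i) → ≡.refl }))
                     (Φ-cong (λ { zero → ≡.refl ; (suc i) → ≡.refl }))))
    Φ′-additive : ∀ μ i → Φ′ (VF.updateAt μ i (const (l+r (suc i))))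
                        ≈ Φ′ (VF.updateAt μ i (const (l (suc i)))) + Φ′ (VF.updateAt μ i (const (r (suc i))))
    Φ′-additive μ i = trans (Φ-cong (λ { zero → ≡.refl ; (suc j) → ≡.refl }))
      (trans (Φ-additive (l+r zero VF.∷ μ) (suc i))
             (+-cong (Φ-cong (λ { zero → ≡.refl ; (suc j) → ≡.refl }))
                     (Φ-cong (λ { zero → ≡.refl ; (suc j) → ≡.refl }))))

isOdd : ℕ → Bool
isOdd n = not (isEven n)

isOdd-+ : (m n : ℕ) → isOdd (m ℕ.+ n) ≡ isOdd m xor isOdd n
isOdd-+ zero    n = ≡.refl
isOdd-+ (suc m) n = ≡.trans (≡.cong not (isOdd-+ m n)) (not-distribˡ-xor (isOdd m) (isOdd n))

xor-interchange : (a b c d : Bool) → (a xor b) xor (c xor d) ≡ (a xor c) xor (b xor d)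
xor-interchange false b false d = ≡.refl
xor-interchange false b true  d = ≡.sym (not-distribʳ-xor b d)
xor-interchange true  b false d = ≡.sym (not-distribˡ-xor b d)
xor-interchange true  b true  d = xor-annihilates-not b d

checkerboard : Fin m → Fin k → Bool
checkerboard i j = isOdd (toℕ i) xor isOdd (toℕ j)

-- The index of row r in the minor that deletes the other row punchIn r i.
swapIndex : Fin (suc (suc k)) → Fin (suc k) → Fin (suc k)
swapIndex zero    i       = zero
swapIndex (suc r) zero    = r
swapIndex {suc k} (suc r) (suc i) = suc (swapIndex r i)

punchIn-swapIndex : (r : Fin (suc (suc k))) (i : Fin (suc k)) → punchIn (punchIn r i) (swapIndex r i) ≡ r
punchIn-swapIndex zero    i       = ≡.refl
punchIn-swapIndex (suc r) zero    = ≡.refl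
punchIn-swapIndex {suc k} (suc r) (suc i) = ≡.cong suc (punchIn-swapIndex r i)

punchIn-swapIndex-punchIn : (r : Fin (suc (suc k))) (i : Fin (suc k)) (a : Fin k) →
  punchIn (punchIn r i) (punchIn (swapIndex r i) a) ≡ punchIn r (punchIn i a)
punchIn-swapIndex-punchIn zero    i       a       = ≡.refl
punchIn-swapIndex-punchIn (suc r) zero    a       = ≡.refl
punchIn-swapIndex-punchIn {suc k} (suc r) (suc i) zero    = ≡.refl
punchIn-swapIndex-punchIn {suc k} (suc r) (suc i) (suc a) = ≡.cong suc (punchIn-swapIndex-punchIn r i a)

checkerboard-swapIndex : (r : Fin (suc (suc k))) (i : Fin (suc k)) →
  checkerboard (punchIn r i) (swapIndex r i) ≡ not (checkerboard r i)
checkerboard-swapIndex zero    i    = xor-identityʳ (not (isOdd (toℕ i)))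
checkerboard-swapIndex (suc r) zero =
  ≡.sym (≡.trans (≡.cong not (xor-identityʳ (isOdd (toℕ (suc r))))) (not-involutive (isOdd (toℕ r))))
checkerboard-swapIndex {suc k} (suc r) (suc i) = begin
  not (o (punchIn r i)) xor not (o (swapIndex r i)) ≡⟨ xor-annihilates-not (o (punchIn r i)) (o (swapIndex r i)) ⟩
  checkerboard (punchIn r i) (swapIndex r i)        ≡⟨ checkerboard-swapIndex r i ⟩
  not (checkerboard r i)                            ≡⟨ ≡.cong not (xor-annihilates-not (o r) (o i)) ⟨
  not (not (o r) xor not (o i))                     ∎
  where
  open ≡-Reasoning
  o : {n : ℕ} → Fin n → Bool
  o i = isOdd (toℕ i)

checkerboard-punchIn-swapIndex : (r c : Fin (suc (suc k))) (i j : Fin (suc k)) →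
  checkerboard (punchIn r i) (punchIn c j) xor checkerboard (swapIndex r i) (swapIndex c j)
    ≡ checkerboard r c xor checkerboard i j
checkerboard-punchIn-swapIndex r c i j = begin
  (o (punchIn r i) xor o (punchIn c j)) xor (o (swapIndex r i) xor o (swapIndex c j))
    ≡⟨ xor-interchange (o (punchIn r i)) (o (punchIn c j)) (o (swapIndex r i)) (o (swapIndex c j)) ⟩
  checkerboard (punchIn r i) (swapIndex r i) xor checkerboard (punchIn c j) (swapIndex c j)
    ≡⟨ ≡.cong₂ _xor_ (checkerboard-swapIndex r i) (checkerboard-swapIndex c j) ⟩
  not (checkerboard r i) xor not (checkerboard c j)
    ≡⟨ xor-annihilates-not (checkerboard r i) (checkerboard c j) ⟩
  (o r xor o i) xor (o c xor o j)
    ≡⟨ xor-interchange (o r) (o i) (o c) (o j) ⟩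
  checkerboard r c xor checkerboard i j ∎
  where
  open ≡-Reasoning
  o : {n : ℕ} → Fin n → Bool
  o i = isOdd (toℕ i)

countTrue : List Bool → ℕ
countTrue bs = length (filter T? bs)

countTrue-++ : (xs ys : List Bool) → countTrue (xs ++ ys) ≡ countTrue xs ℕ.+ countTrue ys
countTrue-++ xs ys = ≡.trans (≡.cong length (filter-++ T? xs ys)) (length-++ (filter T? xs))

inversions-cong : {σ σ′ : Fin k → Fin k} → σ ≗ σ′ → inversions σ ≡ inversions σ′
inversions-cong σ≗σ′ =
  ≡.cong countTrue (pairsTest-cong (λ i j → ≡.cong₂ (λ a b → ⌊ a <? b ⌋) (σ≗σ′ j) (σ≗σ′ i)))

module _ where
  open CommutativeMonoidSums ℕₚ.+-0-commutativeMonoid using (sum-syntax; sum-cong-≗; sum-replicate-zero; ∑-injection)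

  countTrue-tabulate : (p : Fin k → Bool) → countTrue (tabulate p) ≡ ∑[ i < k ] (if p i then 1 else 0)
  countTrue-tabulate {zero}  p = ≡.refl
  countTrue-tabulate {suc k} p with p zero
  ... | true  = ≡.cong suc (countTrue-tabulate (p ∘ suc))
  ... | false = countTrue-tabulate (p ∘ suc)

  ∑-punchIn-below : (x : Fin (suc k)) → ∑[ v < k ] (if ⌊ punchIn x v <? x ⌋ then 1 else 0) ≡ toℕ x
  ∑-punchIn-below {k}     zero    = sum-replicate-zero k
  ∑-punchIn-below {suc k} (suc x) = ≡.cong suc (≡.trans
    (sum-cong-≗ (λ v → ≡.cong (λ b → if b then 1 else 0) (<?-suc (punchIn x v) x)))
    (∑-punchIn-below x))

  inversions-punchIn : (x : Fin (suc k)) (ρ : Fin k → Fin k) → T (isInjection ρ) →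
    inversions (x VF.∷ punchIn x ∘ ρ) ≡ toℕ x ℕ.+ inversions ρ
  inversions-punchIn {k} x ρ ρ-inj = begin
    inversions (x VF.∷ punchIn x ∘ ρ)
      ≡⟨ ≡.cong countTrue (pairsTest-suc (λ i j → ⌊ σ j <? σ i ⌋)) ⟩
    countTrue (tabulate (below ∘ ρ) ++ pairsTest later)
      ≡⟨ countTrue-++ (tabulate (below ∘ ρ)) (pairsTest later) ⟩
    countTrue (tabulate (below ∘ ρ)) ℕ.+ countTrue (pairsTest later)
      ≡⟨ ≡.cong₂ ℕ._+_ (countTrue-tabulate (below ∘ ρ))
                       (≡.cong countTrue (pairsTest-cong (λ i j → <?-punchIn x (ρ j) (ρ i)))) ⟩
    ∑[ j < k ] (if below (ρ j) then 1 else 0) ℕ.+ inversions ρ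
      ≡⟨ ≡.cong (ℕ._+ inversions ρ)
           (≡.trans (∑-injection ρ ρ-inj (λ v → if below v then 1 else 0)) (∑-punchIn-below x)) ⟩
    toℕ x ℕ.+ inversions ρ ∎
    where
    open ≡-Reasoning
    σ : Fin (suc k) → Fin (suc k)
    σ = x VF.∷ punchIn x ∘ ρ
    below : Fin k → Bool
    below v = ⌊ punchIn x v <? x ⌋
    later : Fin k → Fin k → Bool
    later i j = ⌊ punchIn x (ρ j) <? punchIn x (ρ i) ⌋

lookup-removeAt : {A : Set} (S : Vec.Vec A (suc n)) (r : Fin (suc n)) (a : Fin n) →
  Vec.lookup (Vec.removeAt S r) a ≡ Vec.lookup S (punchIn r a)
lookup-removeAt (x ∷ S)     zero    a       = ≡.refl
lookup-removeAt (x ∷ y ∷ S) (suc r) zero    = ≡.refl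
lookup-removeAt (x ∷ y ∷ S) (suc r) (suc a) = lookup-removeAt (y ∷ S) r a

lookup-map : {A B : Set} (f : A → B) (xs : List A) (i : Fin (length (map f xs))) →
  lookup (map f xs) i ≡ f (lookup xs (cast (length-map f xs) i))
lookup-map f (x ∷ xs) zero    = ≡.refl
lookup-map f (x ∷ xs) (suc i) = lookup-map f xs i

module _ {B : Set} {P : Pred B 0ℓ} (P? : Decidable P) where

  filter-map : {A : Set} (f : A → B) (xs : List A) → filter P? (map f xs) ≡ map f (filter (P? ∘ f) xs)
  filter-map f []       = ≡.refl
  filter-map f (x ∷ xs) with ih ← filter-map f xs | does (P? (f x))
  ... | true  = ≡.cong (f x ∷_) ih
  ... | false = ih

  filter-tabulate-punchIn : (f : Fin (suc n) → B) (r : Fin (suc n)) → ¬ P (f r) →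
    filter P? (tabulate f) ≡ filter P? (tabulate (f ∘ punchIn r))
  filter-tabulate-punchIn f zero ¬Pfr = filter-reject P? ¬Pfr
  filter-tabulate-punchIn {suc n} f (suc r) ¬Pfr
    with ih ← filter-tabulate-punchIn (f ∘ suc) r ¬Pfr | does (P? (f zero))
  ... | true  = ≡.cong (f zero ∷_) ih
  ... | false = ih

elems-full : (S : Subset n) → (∀ r → T (Vec.lookup S r)) → elems S ≡ allFin n
elems-full S S-full = filter-all (T? ∘ Vec.lookup S) (tabulate⁺ S-full)

elems-removeAt : (S : Subset (suc n)) (r : Fin (suc n)) → ¬ T (Vec.lookup S r) →
  elems S ≡ map (punchIn r) (elems (Vec.removeAt S r))
elems-removeAt {n} S r r∉S = begin
  filter P? (allFin (suc n))                           ≡⟨ filter-tabulate-punchIn P? id r r∉S ⟩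
  filter P? (tabulate (punchIn r))                     ≡⟨ ≡.cong (filter P?) (map-tabulate id (punchIn r)) ⟨
  filter P? (map (punchIn r) (allFin n))               ≡⟨ filter-map P? (punchIn r) (allFin n) ⟩
  map (punchIn r) (filter (P? ∘ punchIn r) (allFin n))
    ≡⟨ ≡.cong (map (punchIn r)) (filter-≐ (T? ∘ Vec.lookup S′) (P? ∘ punchIn r) S′≐ (allFin n)) ⟨
  map (punchIn r) (elems S′)                           ∎
  where
  open ≡-Reasoning
  P? = T? ∘ Vec.lookup S
  S′ = Vec.removeAt S r
  S′≐ : (T ∘ Vec.lookup S′) ≐ (T ∘ Vec.lookup S ∘ punchIn r)
  S′≐ = (λ {a} → ≡.subst T (lookup-removeAt S r a)) , (λ {a} → ≡.subst T (≡.sym (lookup-removeAt S r a)))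

isOdd-inversions-punchIn : (x : Fin (suc k)) (ρ : Fin k → Fin k) → T (isInjection ρ) →
  isOdd (inversions (x VF.∷ punchIn x ∘ ρ)) ≡ isOdd (toℕ x) xor isOdd (inversions ρ)
isOdd-inversions-punchIn x ρ ρ-inj =
  ≡.trans (≡.cong isOdd (inversions-punchIn x ρ ρ-inj)) (isOdd-+ (toℕ x) (inversions ρ))

module SymmetrizedDeterminant {c ℓ : Level} (R : Ring c ℓ) where
  open Ring R
  open CommutativeMonoidSums +-commutativeMonoid
    using ( ∑ˡ; ∑ˡ-cong; ∑ˡ-homo; ∑ˡ-filter-cong; ∑ˡ-∑-comm; ∑ˡ-injections-suc; ∑ˡ-allSubsets
          ; sum; sum-syntax; sum-cong-≋; ∑-distrib-+; sum-remove; sum-replicate-zero; ∑-homo)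
  open import Algebra.Properties.Monoid.Sum *-monoid using () renaming (sum to product; sum-cong-≋ to product-cong)
  open import Algebra.Properties.Ring R using (-0#≈0#; -‿involutive; -‿+-comm; -‿distribʳ-*; x+x≈x⇒x≈0)
  open import Algebra.Properties.Semiring.Mult semiring using (_×_; ×-congʳ; ×-congˡ; ×-comm-*; ×-assocˡ)
  open import Algebra.Properties.CommutativeMonoid.Mult +-commutativeMonoid using (×-distrib-+)
  open import Relation.Binary.Reasoning.Setoid setoid

  private variable
    X : Set

  Matrix : ℕ → Set c
  Matrix n = Fin n → Fin n → Carrier

  minor : Matrix (suc k) → Fin (suc k) → Fin (suc k) → Matrix k
  minor M i j x y = M (punchIn i x) (punchIn j y)

  infixr 10 ±[_]_
  ±[_]_ : Bool → Carrier → Carrier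
  ±[ b ] x = if b then - x else x

  ±-cong : (b : Bool) {x y : Carrier} → x ≈ y → ±[ b ] x ≈ ±[ b ] y
  ±-cong true  x≈y = -‿cong x≈y
  ±-cong false x≈y = x≈y

  ±-0 : (b : Bool) → ±[ b ] 0# ≈ 0#
  ±-0 true  = -0#≈0#
  ±-0 false = refl

  ±-+ : (b : Bool) (x y : Carrier) → ±[ b ] (x + y) ≈ ±[ b ] x + ±[ b ] y
  ±-+ true  x y = sym (-‿+-comm x y)
  ±-+ false x y = refl

  ±‿distribʳ-* : (b : Bool) (x y : Carrier) → ±[ b ] (x * y) ≈ x * ±[ b ] y
  ±‿distribʳ-* true  x y = -‿distribʳ-* x y
  ±‿distribʳ-* false x y = refl

  ±-± : (a b : Bool) (x : Carrier) → ±[ a ] ±[ b ] x ≈ ±[ a xor b ] x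
  ±-± false b     x = refl
  ±-± true  false x = refl
  ±-± true  true  x = -‿involutive x

  ×-zeroʳ : (n : ℕ) → n × 0# ≈ 0#
  ×-zeroʳ zero    = refl
  ×-zeroʳ (suc n) = trans (+-identityˡ (n × 0#)) (×-zeroʳ n)

  ×-×-comm : (m n : ℕ) (x : Carrier) → m × (n × x) ≈ n × (m × x)
  ×-×-comm m n x = trans (×-assocˡ x m n) (trans (×-congˡ (ℕₚ.*-comm m n)) (sym (×-assocˡ x n m)))

  ±-× : (b : Bool) (n : ℕ) (x : Carrier) → ±[ b ] (n × x) ≈ n × ±[ b ] x
  ±-× b zero    x = ±-0 b
  ±-× b (suc n) x = trans (±-+ b x (n × x)) (+-congˡ (±-× b n x))

  ±-*-×-± : (a b : Bool) (n : ℕ) (x y : Carrier) → ±[ a ] (x * (n × ±[ b ] y)) ≈ n × ±[ a xor b ] (x * y)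
  ±-*-×-± a b n x y = begin
    ±[ a ] (x * (n × ±[ b ] y)) ≈⟨ ±-cong a (×-comm-* n x (±[ b ] y)) ⟩
    ±[ a ] (n × (x * ±[ b ] y)) ≈⟨ ±-× a n (x * ±[ b ] y) ⟩
    n × ±[ a ] (x * ±[ b ] y)   ≈⟨ ×-congʳ n (±-cong a (±‿distribʳ-* b x y)) ⟨
    n × ±[ a ] ±[ b ] (x * y)   ≈⟨ ×-congʳ n (±-± a b (x * y)) ⟩
    n × ±[ a xor b ] (x * y)    ∎

  ∑-± : (b : Bool) (f : Fin n → Carrier) → ∑[ i < n ] ±[ b ] f i ≈ ±[ b ] sum f
  ∑-± b = ∑-homo (±[ b ]_) (±-cong b) (±-0 b) (±-+ b)

  ∑-× : (m : ℕ) (f : Fin n → Carrier) → ∑[ i < n ] (m × f i) ≈ m × sum f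
  ∑-× m = ∑-homo (m ×_) (×-congʳ m) (×-zeroʳ m) (λ x y → ×-distrib-+ x y m)

  ∑ˡ-±-*ˡ : (b : Bool) (a : Carrier) (xs : List X) (f : X → Carrier) →
    ∑[ x ∈ xs ] ±[ b ] (a * f x) ≈ ±[ b ] (a * ∑ˡ xs f)
  ∑ˡ-±-*ˡ b a = ∑ˡ-homo (λ v → ±[ b ] (a * v)) (±-cong b ∘ *-congˡ) (trans (±-cong b (zeroʳ a)) (±-0 b))
                        (λ u v → trans (±-cong b (distribˡ a u v)) (±-+ b (a * u) (a * v)))

  permTerm : Matrix k → (σ τ : Fin k → Fin k) → Carrier
  permTerm M σ τ = ±[ isOdd (inversions σ) xor isOdd (inversions τ) ] product (λ i → M (σ i) (τ i))

  Sdet : Matrix k → Carrier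
  Sdet {k} M = ∑[ σ ∈ Sym k ] ∑[ τ ∈ Sym k ] permTerm M σ τ

  permTerm-cong : (M : Matrix k) {σ σ′ τ τ′ : Fin k → Fin k} → σ ≗ σ′ → τ ≗ τ′ →
    permTerm M σ τ ≈ permTerm M σ′ τ′
  permTerm-cong M {σ} σ≗σ′ τ≗τ′ = trans
    (reflexive (≡.cong₂ (λ a b → ±[ isOdd a xor isOdd b ] product (λ i → M (σ i) _))
                        (inversions-cong σ≗σ′) (inversions-cong τ≗τ′)))
    (±-cong _ (product-cong (λ i → reflexive (≡.cong₂ M (σ≗σ′ i) (τ≗τ′ i)))))

  Sdet-cong : {M N : Matrix k} → (∀ i j → M i j ≈ N i j) → Sdet M ≈ Sdet N
  Sdet-cong {k} M≈N =
    ∑ˡ-cong (Sym k) (λ σ → ∑ˡ-cong (Sym k) (λ τ → ±-cong _ (product-cong (λ i → M≈N (σ i) (τ i)))))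

  permTerm-punchIn : (M : Matrix (suc k)) (x y : Fin (suc k)) {ρ π : Fin k → Fin k} →
    T (isInjection ρ) → T (isInjection π) →
    permTerm M (x VF.∷ punchIn x ∘ ρ) (y VF.∷ punchIn y ∘ π)
      ≈ ±[ checkerboard x y ] (M x y * permTerm (minor M x y) ρ π)
  permTerm-punchIn M x y {ρ} {π} ρ-inj π-inj = begin
    ±[ isOdd (inversions (x VF.∷ punchIn x ∘ ρ)) xor isOdd (inversions (y VF.∷ punchIn y ∘ π)) ] (M x y * P)
      ≡⟨ ≡.cong (λ s → ±[ s ] (M x y * P)) parity ⟩
    ±[ checkerboard x y xor sρπ ] (M x y * P)   ≈⟨ ±-± (checkerboard x y) sρπ (M x y * P) ⟨
    ±[ checkerboard x y ] ±[ sρπ ] (M x y * P)  ≈⟨ ±-cong (checkerboard x y) (±‿distribʳ-* sρπ (M x y) P) ⟩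
    ±[ checkerboard x y ] (M x y * permTerm (minor M x y) ρ π) ∎
    where
    P = product (λ z → minor M x y (ρ z) (π z))
    sρπ = isOdd (inversions ρ) xor isOdd (inversions π)
    parity : isOdd (inversions (x VF.∷ punchIn x ∘ ρ)) xor isOdd (inversions (y VF.∷ punchIn y ∘ π))
           ≡ checkerboard x y xor sρπ
    parity = ≡.trans (≡.cong₂ _xor_ (isOdd-inversions-punchIn x ρ ρ-inj) (isOdd-inversions-punchIn y π π-inj))
                     (xor-interchange (isOdd (toℕ x)) (isOdd (inversions ρ)) (isOdd (toℕ y)) (isOdd (inversions π)))

  laplaceTerm : Matrix (suc k) → Fin (suc k) → Fin (suc k) → Carrier
  laplaceTerm M i j = ±[ checkerboard i j ] (M i j * Sdet (minor M i j))

  Sdet-suc : (M : Matrix (suc k)) → Sdet M ≈ ∑[ i < suc k ] ∑[ j < suc k ] laplaceTerm M i j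
  Sdet-suc {k} M = begin
    ∑[ σ ∈ Sym (suc k) ] ∑[ τ ∈ Sym (suc k) ] permTerm M σ τ
      ≈⟨ ∑ˡ-injections-suc (λ σ → ∑[ τ ∈ Sym (suc k) ] permTerm M σ τ)
           (λ σ≗σ′ → ∑ˡ-cong (Sym (suc k)) (λ τ → permTerm-cong M σ≗σ′ (λ _ → ≡.refl))) ⟩
    ∑[ x < suc k ] ∑[ ρ ∈ Sym k ] ∑[ τ ∈ Sym (suc k) ] permTerm M (x VF.∷ punchIn x ∘ ρ) τ
      ≈⟨ sum-cong-≋ (λ x → ∑ˡ-filter-cong isInjection (allFuns k k) (λ ρ ρ-inj →
           trans (∑ˡ-injections-suc (permTerm M (x VF.∷ punchIn x ∘ ρ)) (permTerm-cong M (λ _ → ≡.refl)))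
                 (sum-cong-≋ (λ y → ∑ˡ-filter-cong isInjection (allFuns k k) (λ π π-inj →
                   permTerm-punchIn M x y ρ-inj π-inj))))) ⟩
    ∑[ x < suc k ] ∑[ ρ ∈ Sym k ] ∑[ y < suc k ] ∑[ π ∈ Sym k ] term x y ρ π
      ≈⟨ sum-cong-≋ (λ x → ∑ˡ-∑-comm (Sym k) (λ ρ y → ∑[ π ∈ Sym k ] term x y ρ π)) ⟩
    ∑[ x < suc k ] ∑[ y < suc k ] ∑[ ρ ∈ Sym k ] ∑[ π ∈ Sym k ] term x y ρ π
      ≈⟨ sum-cong-≋ (λ x → sum-cong-≋ (λ y → trans
           (∑ˡ-cong (Sym k) (λ ρ → ∑ˡ-±-*ˡ (checkerboard x y) (M x y) (Sym k) (permTerm (minor M x y) ρ)))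
           (∑ˡ-±-*ˡ (checkerboard x y) (M x y) (Sym k) (λ ρ → ∑[ π ∈ Sym k ] permTerm (minor M x y) ρ π)))) ⟩
    ∑[ x < suc k ] ∑[ y < suc k ] laplaceTerm M x y ∎
    where
    term : Fin (suc k) → Fin (suc k) → (ρ π : Fin k → Fin k) → Carrier
    term x y ρ π = ±[ checkerboard x y ] (M x y * permTerm (minor M x y) ρ π)

  -- split is required for every x ≡ r, not only for r, so that it transports along index equations.
  record RowSplit {n : ℕ} (r : Fin n) (M M₁ M₂ : Matrix n) : Set ℓ where
    field
      agree₁ : ∀ {x} → x ≢ r → ∀ y → M x y ≈ M₁ x y
      agree₂ : ∀ {x} → x ≢ r → ∀ y → M x y ≈ M₂ x y
      split  : ∀ {x} → x ≡ r → ∀ y → M x y ≈ M₁ x y + M₂ x y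

  RowSplit-minor : {r i : Fin (suc k)} {M M₁ M₂ : Matrix (suc k)} →
    RowSplit r M M₁ M₂ → (i≢r : i ≢ r) → ∀ j →
    RowSplit (punchOut i≢r) (minor M i j) (minor M₁ i j) (minor M₂ i j)
  RowSplit-minor {i = i} MSplit i≢r j = record
    { agree₁ = λ x≢r′ y → agree₁ (x≢r′ ∘ punchIn≡r⇒) (punchIn j y)
    ; agree₂ = λ x≢r′ y → agree₂ (x≢r′ ∘ punchIn≡r⇒) (punchIn j y)
    ; split  = λ x≡r′ y → split (≡.trans (≡.cong (punchIn i) x≡r′) (punchIn-punchOut i≢r)) (punchIn j y)
    }
    where
    open RowSplit MSplit
    punchIn≡r⇒ : ∀ {x} → punchIn i x ≡ _ → x ≡ punchOut i≢r
    punchIn≡r⇒ {x} eq = punchIn-injective i x (punchOut i≢r) (≡.trans eq (≡.sym (punchIn-punchOut i≢r)))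

  Sdet-rowSplit : {r : Fin n} {M M₁ M₂ : Matrix n} → RowSplit r M M₁ M₂ → Sdet M ≈ Sdet M₁ + Sdet M₂
  Sdet-rowSplit {suc k} {r} {M} {M₁} {M₂} MSplit = begin
    Sdet M                                                  ≈⟨ Sdet-suc M ⟩
    ∑[ i < suc k ] ∑[ j < suc k ] laplaceTerm M i j         ≈⟨ sum-cong-≋ (λ i → sum-cong-≋ (term i)) ⟩
    ∑[ i < suc k ] ∑[ j < suc k ] (laplaceTerm M₁ i j + laplaceTerm M₂ i j)
      ≈⟨ sum-cong-≋ (λ i → ∑-distrib-+ (laplaceTerm M₁ i) (laplaceTerm M₂ i)) ⟩
    ∑[ i < suc k ] (∑[ j < suc k ] laplaceTerm M₁ i j + ∑[ j < suc k ] laplaceTerm M₂ i j)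
      ≈⟨ ∑-distrib-+ (λ i → ∑[ j < suc k ] laplaceTerm M₁ i j) (λ i → ∑[ j < suc k ] laplaceTerm M₂ i j) ⟩
    ∑[ i < suc k ] ∑[ j < suc k ] laplaceTerm M₁ i j + ∑[ i < suc k ] ∑[ j < suc k ] laplaceTerm M₂ i j
      ≈⟨ +-cong (Sdet-suc M₁) (Sdet-suc M₂) ⟨
    Sdet M₁ + Sdet M₂                                       ∎
    where
    open RowSplit MSplit
    term : ∀ i j → laplaceTerm M i j ≈ laplaceTerm M₁ i j + laplaceTerm M₂ i j
    term i j with i ≟ r
    ... | yes ≡.refl = trans (±-cong (checkerboard i j) (begin
      M i j * Sdet (minor M i j)                                  ≈⟨ *-congʳ (split ≡.refl j) ⟩
      (M₁ i j + M₂ i j) * Sdet (minor M i j)                      ≈⟨ distribʳ _ _ _ ⟩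
      M₁ i j * Sdet (minor M i j) + M₂ i j * Sdet (minor M i j)
        ≈⟨ +-cong (*-congˡ (Sdet-cong (λ x y → agree₁ (punchInᵢ≢i i x) (punchIn j y))))
                  (*-congˡ (Sdet-cong (λ x y → agree₂ (punchInᵢ≢i i x) (punchIn j y)))) ⟩
      M₁ i j * Sdet (minor M₁ i j) + M₂ i j * Sdet (minor M₂ i j) ∎))
      (±-+ (checkerboard i j) _ _)
    ... | no i≢r = trans (±-cong (checkerboard i j) (begin
      M i j * Sdet (minor M i j)
        ≈⟨ *-congˡ (Sdet-rowSplit (RowSplit-minor MSplit i≢r j)) ⟩
      M i j * (Sdet (minor M₁ i j) + Sdet (minor M₂ i j))
        ≈⟨ distribˡ _ _ _ ⟩
      M i j * Sdet (minor M₁ i j) + M i j * Sdet (minor M₂ i j)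
        ≈⟨ +-cong (*-congʳ (agree₁ i≢r j)) (*-congʳ (agree₂ i≢r j)) ⟩
      M₁ i j * Sdet (minor M₁ i j) + M₂ i j * Sdet (minor M₂ i j) ∎))
      (±-+ (checkerboard i j) _ _)

  Sdet-zeroRow : (M : Matrix n) (r : Fin n) → (∀ y → M r y ≈ 0#) → Sdet M ≈ 0#
  Sdet-zeroRow M r zero-row = x+x≈x⇒x≈0 (Sdet M) (sym (Sdet-rowSplit MSplit))
    where
    MSplit : RowSplit r M M M
    MSplit = record
      { agree₁ = λ _ _ → refl
      ; agree₂ = λ _ _ → refl
      ; split  = λ { ≡.refl y →
          trans (zero-row y) (trans (sym (+-identityˡ 0#)) (sym (+-cong (zero-row y) (zero-row y)))) }
      }

  Sdet-+ᴹ : (A B : Matrix n) → Sdet (λ i j → A i j + B i j) ≈ ∑[ S ∈ allSubsets n ] Sdet (select S A B)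
  Sdet-+ᴹ A B = sym (∑ˡ-allSubsets A B (λ i j → A i j + B i j) Sdet
    (λ μ≗ν → Sdet-cong (λ i j → reflexive (≡.cong (λ row → row j) (μ≗ν i))))
    (λ μ i → Sdet-rowSplit (record
      { agree₁ = untouched μ i
      ; agree₂ = untouched μ i
      ; split  = λ { ≡.refl y → reflexive (≡.trans (≡.cong (λ u → u y) (updateAt-updates i μ))
                   (≡.sym (≡.cong₂ (λ u v → u y + v y) (updateAt-updates i μ) (updateAt-updates i μ)))) }
      })))
    where
    untouched : ∀ μ i {u v} {x} → x ≢ i → ∀ y →
      VF.updateAt μ i (const u) x y ≈ VF.updateAt μ i (const v) x y
    untouched μ i {x = x} x≢i y =
      reflexive (≡.cong (λ row → row y)
        (≡.trans (updateAt-minimal x i μ x≢i) (≡.sym (updateAt-minimal x i μ x≢i))))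

  -- SDet.I over an arbitrary ring; the two agree definitionally.
  1ᴹ : Matrix n
  1ᴹ i j = if ⌊ i ≟ j ⌋ then 1# else 0#

  1ᴹ-diagonal : (c : Fin n) → 1ᴹ c c ≈ 1#
  1ᴹ-diagonal c = reflexive (≡.cong (λ b → if b then 1# else 0#) (≟-≡ ≡.refl))

  1ᴹ-punchIn : (c : Fin (suc n)) (y : Fin n) → 1ᴹ c (punchIn c y) ≈ 0#
  1ᴹ-punchIn c y = reflexive (≡.cong (λ b → if b then 1# else 0#) (≟-≢ (punchInᵢ≢i c y ∘ ≡.sym)))

  1ᴹ-minor : (j : Fin (suc n)) (c y : Fin n) → 1ᴹ (punchIn j c) (punchIn j y) ≡ 1ᴹ c y
  1ᴹ-minor j c y = ≡.cong (λ b → if b then 1# else 0#) (≟-punchIn j c y)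

  module _ (M : Matrix (suc (suc k))) (r c : Fin (suc (suc k))) (unit : ∀ y → M r y ≈ 1ᴹ c y)
           (i : Fin (suc k)) where

    minor-unitRow : (j : Fin (suc k)) →
      ∀ y → minor M (punchIn r i) (punchIn c j) (swapIndex r i) y ≈ 1ᴹ (swapIndex c j) y
    minor-unitRow j y = begin
      M (punchIn (punchIn r i) (swapIndex r i)) (punchIn (punchIn c j) y)
        ≡⟨ ≡.cong (λ x → M x (punchIn (punchIn c j) y)) (punchIn-swapIndex r i) ⟩
      M r (punchIn (punchIn c j) y)
        ≈⟨ unit (punchIn (punchIn c j) y) ⟩
      1ᴹ c (punchIn (punchIn c j) y)
        ≡⟨ ≡.cong (λ z → 1ᴹ z (punchIn (punchIn c j) y)) (punchIn-swapIndex c j) ⟨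
      1ᴹ (punchIn (punchIn c j) (swapIndex c j)) (punchIn (punchIn c j) y)
        ≡⟨ 1ᴹ-minor (punchIn c j) (swapIndex c j) y ⟩
      1ᴹ (swapIndex c j) y ∎

    minor-zeroRow : ∀ y → minor M (punchIn r i) c (swapIndex r i) y ≈ 0#
    minor-zeroRow y = begin
      M (punchIn (punchIn r i) (swapIndex r i)) (punchIn c y)
        ≡⟨ ≡.cong (λ x → M x (punchIn c y)) (punchIn-swapIndex r i) ⟩
      M r (punchIn c y)  ≈⟨ unit (punchIn c y) ⟩
      1ᴹ c (punchIn c y) ≈⟨ 1ᴹ-punchIn c y ⟩
      0#                 ∎

    laplaceTerm-unitColumn : laplaceTerm M (punchIn r i) c ≈ 0#
    laplaceTerm-unitColumn = trans (±-cong (checkerboard (punchIn r i) c)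
      (trans (*-congˡ (Sdet-zeroRow (minor M (punchIn r i) c) (swapIndex r i) minor-zeroRow)) (zeroʳ _)))
      (±-0 (checkerboard (punchIn r i) c))

  ∑-laplaceTerm-unitRow : (M : Matrix (suc k)) (r c : Fin (suc k)) → (∀ y → M r y ≈ 1ᴹ c y) →
    ∑[ j < suc k ] laplaceTerm M r j ≈ ±[ checkerboard r c ] Sdet (minor M r c)
  ∑-laplaceTerm-unitRow {k} M r c unit = begin
    ∑[ j < suc k ] laplaceTerm M r j                             ≈⟨ sum-remove {i = c} (laplaceTerm M r) ⟩
    laplaceTerm M r c + ∑[ j < k ] laplaceTerm M r (punchIn c j)
      ≈⟨ +-cong (±-cong (checkerboard r c) (trans (*-congʳ (trans (unit c) (1ᴹ-diagonal c))) (*-identityˡ _)))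
                (trans (sum-cong-≋ offDiagonal) (sum-replicate-zero k)) ⟩
    ±[ checkerboard r c ] Sdet (minor M r c) + 0#                ≈⟨ +-identityʳ _ ⟩
    ±[ checkerboard r c ] Sdet (minor M r c)                     ∎
    where
    offDiagonal : ∀ j → laplaceTerm M r (punchIn c j) ≈ 0#
    offDiagonal j = trans (±-cong (checkerboard r (punchIn c j))
      (trans (*-congʳ (trans (unit (punchIn c j)) (1ᴹ-punchIn c j))) (zeroˡ _))) (±-0 _)

  Sdet-unitRow : (M : Matrix (suc k)) (r c : Fin (suc k)) → (∀ y → M r y ≈ 1ᴹ c y) →
    Sdet M ≈ suc k × ±[ checkerboard r c ] Sdet (minor M r c)
  ∑-laplaceTerm-otherRows : (M : Matrix (suc k)) (r c : Fin (suc k)) → (∀ y → M r y ≈ 1ᴹ c y) →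
    ∑[ i < k ] ∑[ j < suc k ] laplaceTerm M (punchIn r i) j ≈ k × ±[ checkerboard r c ] Sdet (minor M r c)
  laplaceTerm-otherRow : (M : Matrix (suc (suc k))) (r c : Fin (suc (suc k))) → (∀ y → M r y ≈ 1ᴹ c y) →
    ∀ i j → laplaceTerm M (punchIn r i) (punchIn c j) ≈ suc k × ±[ checkerboard r c ] laplaceTerm (minor M r c) i j

  Sdet-unitRow {k} M r c unit = begin
    Sdet M                                           ≈⟨ Sdet-suc M ⟩
    ∑[ i < suc k ] ∑[ j < suc k ] laplaceTerm M i j
      ≈⟨ sum-remove {i = r} (λ i → ∑[ j < suc k ] laplaceTerm M i j) ⟩
    ∑[ j < suc k ] laplaceTerm M r j + ∑[ i < k ] ∑[ j < suc k ] laplaceTerm M (punchIn r i) j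
      ≈⟨ +-cong (∑-laplaceTerm-unitRow M r c unit) (∑-laplaceTerm-otherRows M r c unit) ⟩
    suc k × ±[ checkerboard r c ] Sdet (minor M r c) ∎

  ∑-laplaceTerm-otherRows {zero}  M r c unit = refl
  ∑-laplaceTerm-otherRows {suc k} M r c unit = begin
    ∑[ i < suc k ] ∑[ j < suc (suc k) ] laplaceTerm M (punchIn r i) j ≈⟨ sum-cong-≋ row ⟩
    ∑[ i < suc k ] (suc k × ±[ s ] ∑[ j < suc k ] laplaceTerm N i j)
      ≈⟨ ∑-× (suc k) (λ i → ±[ s ] ∑[ j < suc k ] laplaceTerm N i j) ⟩
    suc k × ∑[ i < suc k ] ±[ s ] ∑[ j < suc k ] laplaceTerm N i j
      ≈⟨ ×-congʳ (suc k) (∑-± s (λ i → ∑[ j < suc k ] laplaceTerm N i j)) ⟩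
    suc k × ±[ s ] ∑[ i < suc k ] ∑[ j < suc k ] laplaceTerm N i j
      ≈⟨ ×-congʳ (suc k) (±-cong s (Sdet-suc N)) ⟨
    suc k × ±[ s ] Sdet N ∎
    where
    s = checkerboard r c
    N = minor M r c
    row : ∀ i → ∑[ j < suc (suc k) ] laplaceTerm M (punchIn r i) j ≈ suc k × ±[ s ] ∑[ j < suc k ] laplaceTerm N i j
    row i = begin
      ∑[ j < suc (suc k) ] laplaceTerm M (punchIn r i) j
        ≈⟨ sum-remove {i = c} (laplaceTerm M (punchIn r i)) ⟩
      laplaceTerm M (punchIn r i) c + ∑[ j < suc k ] laplaceTerm M (punchIn r i) (punchIn c j)
        ≈⟨ +-cong (laplaceTerm-unitColumn M r c unit i) (sum-cong-≋ (laplaceTerm-otherRow M r c unit i)) ⟩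
      0# + ∑[ j < suc k ] (suc k × ±[ s ] laplaceTerm N i j)  ≈⟨ +-identityˡ _ ⟩
      ∑[ j < suc k ] (suc k × ±[ s ] laplaceTerm N i j)       ≈⟨ ∑-× (suc k) (λ j → ±[ s ] laplaceTerm N i j) ⟩
      suc k × ∑[ j < suc k ] ±[ s ] laplaceTerm N i j         ≈⟨ ×-congʳ (suc k) (∑-± s (laplaceTerm N i)) ⟩
      suc k × ±[ s ] ∑[ j < suc k ] laplaceTerm N i j         ∎

  laplaceTerm-otherRow {k} M r c unit i j = begin
    ±[ a ] (M i′ j′ * Sdet (minor M i′ j′))
      ≈⟨ ±-cong a (*-congˡ (Sdet-unitRow (minor M i′ j′) (swapIndex r i) (swapIndex c j)
                                         (minor-unitRow M r c unit i j))) ⟩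
    ±[ a ] (M i′ j′ * (suc k × ±[ b ] Sdet (minor (minor M i′ j′) (swapIndex r i) (swapIndex c j))))
      ≈⟨ ±-cong a (*-congˡ (×-congʳ (suc k) (±-cong b (Sdet-cong (λ x y →
           reflexive (≡.cong₂ M (punchIn-swapIndex-punchIn r i x) (punchIn-swapIndex-punchIn c j y))))))) ⟩
    ±[ a ] (M i′ j′ * (suc k × ±[ b ] Sdet (minor N i j)))
      ≈⟨ ±-*-×-± a b (suc k) (M i′ j′) (Sdet (minor N i j)) ⟩
    suc k × ±[ a xor b ] (N i j * Sdet (minor N i j))
      ≡⟨ ≡.cong (λ t → suc k × ±[ t ] (N i j * Sdet (minor N i j))) (checkerboard-punchIn-swapIndex r c i j) ⟩
    suc k × ±[ checkerboard r c xor checkerboard i j ] (N i j * Sdet (minor N i j))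
      ≈⟨ ×-congʳ (suc k) (±-± (checkerboard r c) (checkerboard i j) _) ⟨
    suc k × ±[ checkerboard r c ] laplaceTerm N i j ∎
    where
    N = minor M r c
    i′ = punchIn r i
    j′ = punchIn c j
    a = checkerboard i′ j′
    b = checkerboard (swapIndex r i) (swapIndex c j)

  Sdet-cast : {m n : ℕ} (m≡n : m ≡ n) {M : Matrix m} {N : Matrix n} →
    (∀ i j → M i j ≈ N (cast m≡n i) (cast m≡n j)) → Sdet M ≈ Sdet N
  Sdet-cast ≡.refl {N = N} M≈N =
    Sdet-cong (λ i j → trans (M≈N i j) (reflexive (≡.cong₂ N (cast-is-id ≡.refl i) (cast-is-id ≡.refl j))))

  restrict : Matrix n → (L : List (Fin n)) → Matrix (length L)
  restrict M L i j = M (lookup L i) (lookup L j)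

  Sdet-restrict-allFin : (M : Matrix n) → Sdet M ≈ Sdet (restrict M (allFin n))
  Sdet-restrict-allFin {n} M = Sdet-cast (≡.sym (length-tabulate id)) {N = restrict M (allFin n)}
    (λ i j → reflexive (≡.sym (≡.cong₂ M (lookup-tabulate id i) (lookup-tabulate id j))))

  Sdet-restrict-map : (M : Matrix n) (f : Fin m → Fin n) (L : List (Fin m)) →
    Sdet (restrict M (map f L)) ≈ Sdet (restrict (λ x y → M (f x) (f y)) L)
  Sdet-restrict-map M f L = Sdet-cast (length-map f L) {N = restrict (λ x y → M (f x) (f y)) L}
    (λ i j → reflexive (≡.cong₂ M (lookup-map f L i) (lookup-map f L j)))

  Sdet-restrict-removeAt : (A : Matrix (suc n)) (S : Subset (suc n)) {r : Fin (suc n)} → ¬ T (Vec.lookup S r) →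
    Sdet (restrict A (elems S)) ≈ Sdet (restrict (minor A r r) (elems (Vec.removeAt S r)))
  Sdet-restrict-removeAt A S {r} r∉S = trans
    (reflexive (≡.cong (λ L → Sdet (restrict A L)) (elems-removeAt S r r∉S)))
    (Sdet-restrict-map A (punchIn r) (elems (Vec.removeAt S r)))

  Sdet-select-full : (A B : Matrix n) (S : Subset n) → (∀ r → T (Vec.lookup S r)) →
    Sdet (select S A B) ≈ Sdet (restrict A (elems S))
  Sdet-select-full {n} A B S S-full = begin
    Sdet (select S A B)
      ≈⟨ Sdet-cong (λ i j → reflexive (≡.cong (λ row → row j) (select-∈ S {A} {B} (S-full i)))) ⟩
    Sdet A
      ≈⟨ Sdet-restrict-allFin A ⟩
    Sdet (restrict A (allFin n))
      ≡⟨ ≡.cong (λ L → Sdet (restrict A L)) (elems-full S S-full) ⟨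
    Sdet (restrict A (elems S)) ∎

  Sdet-select-1ᴹ-removeAt : (A : Matrix (suc n)) (S : Subset (suc n)) {r : Fin (suc n)} → ¬ T (Vec.lookup S r) →
    Sdet (select S A 1ᴹ) ≈ suc n × Sdet (select (Vec.removeAt S r) (minor A r r) 1ᴹ)
  Sdet-select-1ᴹ-removeAt {n} A S {r} r∉S = begin
    Sdet (select S A 1ᴹ)
      ≈⟨ Sdet-unitRow (select S A 1ᴹ) r r unit ⟩
    suc n × ±[ checkerboard r r ] Sdet (minor (select S A 1ᴹ) r r)
      ≡⟨ ≡.cong (λ b → suc n × ±[ b ] Sdet (minor (select S A 1ᴹ) r r)) (xor-same (isOdd (toℕ r))) ⟩
    suc n × Sdet (minor (select S A 1ᴹ) r r)
      ≈⟨ ×-congʳ (suc n) (Sdet-cong minor-select) ⟩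
    suc n × Sdet (select (Vec.removeAt S r) (minor A r r) 1ᴹ) ∎
    where
    unit : ∀ y → select S A 1ᴹ r y ≈ 1ᴹ r y
    unit y = reflexive (≡.cong (λ row → row y) (select-∉ S {A} {1ᴹ} r∉S))
    minor-select : ∀ x y → minor (select S A 1ᴹ) r r x y ≈ select (Vec.removeAt S r) (minor A r r) 1ᴹ x y
    minor-select x y rewrite lookup-removeAt S r x with Vec.lookup S (punchIn r x)
    ... | true  = refl
    ... | false = reflexive (1ᴹ-minor r x y)

  Sdet-select-1ᴹ : (A : Matrix n) (S : Subset n) →
    (length (elems S) !) × Sdet (select S A 1ᴹ) ≈ (n !) × Sdet (restrict A (elems S))
  Sdet-select-1ᴹ {zero} A [] = refl
  Sdet-select-1ᴹ {suc n} A S with all? (T? ∘ Vec.lookup S)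
  ... | yes S-full = begin
    (length (elems S) !) × Sdet (select S A 1ᴹ)
      ≡⟨ ≡.cong (λ L → (length L !) × Sdet (select S A 1ᴹ)) (elems-full S S-full) ⟩
    (length (allFin (suc n)) !) × Sdet (select S A 1ᴹ)
      ≡⟨ ≡.cong (λ m → (m !) × Sdet (select S A 1ᴹ)) (length-tabulate {n = suc n} id) ⟩
    (suc n !) × Sdet (select S A 1ᴹ)
      ≈⟨ ×-congʳ (suc n !) (Sdet-select-full A 1ᴹ S S-full) ⟩
    (suc n !) × Sdet (restrict A (elems S)) ∎
  ... | no S-notFull with ¬∀⟶∃¬ (suc n) (T ∘ Vec.lookup S) (T? ∘ Vec.lookup S) S-notFull
  ...   | r , r∉S = begin
    (length (elems S) !) × Sdet (select S A 1ᴹ)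
      ≡⟨ ≡.cong (λ m → (m !) × Sdet (select S A 1ᴹ))
                (≡.trans (≡.cong length (elems-removeAt S r r∉S)) (length-map (punchIn r) (elems S′))) ⟩
    (length (elems S′) !) × Sdet (select S A 1ᴹ)
      ≈⟨ ×-congʳ (length (elems S′) !) (Sdet-select-1ᴹ-removeAt A S r∉S) ⟩
    (length (elems S′) !) × (suc n × Sdet (select S′ A′ 1ᴹ))
      ≈⟨ ×-×-comm (length (elems S′) !) (suc n) (Sdet (select S′ A′ 1ᴹ)) ⟩
    suc n × ((length (elems S′) !) × Sdet (select S′ A′ 1ᴹ))
      ≈⟨ ×-congʳ (suc n) (Sdet-select-1ᴹ A′ S′) ⟩
    suc n × ((n !) × Sdet (restrict A′ (elems S′)))
      ≈⟨ ×-assocˡ (Sdet (restrict A′ (elems S′))) (suc n) (n !) ⟩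
    (suc n !) × Sdet (restrict A′ (elems S′))
      ≈⟨ ×-congʳ (suc n !) (Sdet-restrict-removeAt A S r∉S) ⟨
    (suc n !) × Sdet (restrict A (elems S)) ∎
    where
    S′ = Vec.removeAt S r
    A′ = minor A r r

module _ {c ℓ a ℓa : Level} (K : Field c ℓ) (cz : CharZero K) (𝒜 : Algebra K a ℓa) where
  open SDet K cz 𝒜
  open Algebra 𝒜
  open SymmetrizedDeterminant ring using (±[_]_; ±-±; permTerm; Sdet)
  open MonoidSums *-monoid using () renaming (∑ˡ-tabulate to ∏ˡ-tabulate)
  open CommutativeMonoidSums +-commutativeMonoid using (∑ˡ-homo; ∑ˡ-cong)
  open import Algebra.Properties.Ring ring using (-1*x≈-x; x+x≈x⇒x≈0)
  open import Algebra.Properties.Monoid.Mult +-monoid using (_×_)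
  open import Relation.Binary.Reasoning.Setoid setoid

  private variable
    X : Set

  sgn-* : (σ : Fin k → Fin k) (x : Carrier) → sgn σ * x ≈ ±[ isOdd (inversions σ) ] x
  sgn-* σ x with isEven (inversions σ)
  ... | true  = *-identityˡ x
  ... | false = -1*x≈-x x

  sdet≈invFact·Sdet : (M : Mat k) → sdet M ≈ invFact k · Sdet M
  sdet≈invFact·Sdet {k} M = ·-cong K.refl (∑ˡ-cong (Sym k) (λ σ → ∑ˡ-cong (Sym k) (λ τ → begin
    (sgn σ * sgn τ) * Π k (λ i → M (σ i) (τ i))                                  ≈⟨ *-assoc (sgn σ) (sgn τ) _ ⟩
    sgn σ * (sgn τ * Π k (λ i → M (σ i) (τ i)))                                  ≈⟨ *-congˡ (sgn-* τ _) ⟩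
    sgn σ * ±[ isOdd (inversions τ) ] Π k (λ i → M (σ i) (τ i))                  ≈⟨ sgn-* σ _ ⟩
    ±[ isOdd (inversions σ) ] ±[ isOdd (inversions τ) ] Π k (λ i → M (σ i) (τ i))
      ≈⟨ ±-± (isOdd (inversions σ)) (isOdd (inversions τ)) _ ⟩
    ±[ isOdd (inversions σ) xor isOdd (inversions τ) ] Π k (λ i → M (σ i) (τ i))
      ≡⟨ ≡.cong (±[ isOdd (inversions σ) xor isOdd (inversions τ) ]_) (∏ˡ-tabulate id (λ i → M (σ i) (τ i))) ⟩
    permTerm M σ τ ∎)))

  ·-zeroʳ : (λ₁ : K.Carrier) → λ₁ · 0# ≈ 0#
  ·-zeroʳ λ₁ = x+x≈x⇒x≈0 (λ₁ · 0#) (trans (sym (·-distribˡ λ₁ 0# 0#)) (·-cong K.refl (+-identityˡ 0#)))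

  ·-zeroˡ : (x : Carrier) → K.0# · x ≈ 0#
  ·-zeroˡ x = x+x≈x⇒x≈0 (K.0# · x) (trans (sym (·-distribʳ K.0# K.0# x)) (·-cong (K.+-identityˡ K.0#) refl))

  ·-∑ˡ : (λ₁ : K.Carrier) (xs : List X) (f : X → Carrier) → λ₁ · Σ xs f ≈ Σ xs (λ x → λ₁ · f x)
  ·-∑ˡ λ₁ xs f = sym (∑ˡ-homo (λ₁ ·_) (·-cong K.refl) (·-zeroʳ λ₁) (·-distribˡ λ₁) xs f)

  ·-comm : (λ₁ λ₂ : K.Carrier) (x : Carrier) → λ₁ · (λ₂ · x) ≈ λ₂ · (λ₁ · x)
  ·-comm λ₁ λ₂ x =
    trans (sym (·-assoc λ₁ λ₂ x)) (trans (·-cong (K.*-comm λ₁ λ₂) refl) (·-assoc λ₂ λ₁ x))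

  fromℕ-· : (n : ℕ) (x : Carrier) → fromℕ K n · x ≈ n × x
  fromℕ-· zero    x = ·-zeroˡ x
  fromℕ-· (suc n) x = trans (·-distribʳ K.1# (fromℕ K n) x) (+-cong (·-identity x) (fromℕ-· n x))

  invFact-·-× : (k : ℕ) (x : Carrier) → invFact k · ((k !) × x) ≈ x
  invFact-·-× k x = begin
    invFact k · ((k !) × x)            ≈⟨ ·-cong K.refl (fromℕ-· (k !) x) ⟨
    invFact k · (fromℕ K (k !) · x)    ≈⟨ ·-assoc (invFact k) (fromℕ K (k !)) x ⟨
    (invFact k K.* fromℕ K (k !)) · x  ≈⟨ ·-cong (K.trans (K.*-comm _ _) (K.inv-inverseʳ _ _)) refl ⟩
    K.1# · x                           ≈⟨ ·-identity x ⟩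
    x                                  ∎

  invFact-cancel : (m n : ℕ) {w x : Carrier} → (m !) × w ≈ (n !) × x → invFact n · w ≈ invFact m · x
  invFact-cancel m n {w} {x} m!w≈n!x = begin
    invFact n · w                          ≈⟨ ·-cong K.refl (invFact-·-× m w) ⟨
    invFact n · (invFact m · ((m !) × w))  ≈⟨ ·-cong K.refl (·-cong K.refl m!w≈n!x) ⟩
    invFact n · (invFact m · ((n !) × x))  ≈⟨ ·-comm (invFact n) (invFact m) ((n !) × x) ⟩
    invFact m · (invFact n · ((n !) × x))  ≈⟨ ·-cong K.refl (invFact-·-× n x) ⟩
    invFact m · x                          ∎

theorem3p2 : {c ℓ a ℓa : Level} (K : Field c ℓ) (cz : CharZero K) (𝒜 : Algebra K a ℓa)
    (n : ℕ) (A : SDet.Mat K cz 𝒜 n)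
    → Algebra._≈_ 𝒜
        (SDet.sdet K cz 𝒜 (SDet._+ᴹ_ K cz 𝒜 A (SDet.I K cz 𝒜)))
        (SDet.Σ K cz 𝒜 (allSubsets n) (λ S → SDet.sdet K cz 𝒜 (SDet.principal K cz 𝒜 A S)))
theorem3p2 K cz 𝒜 n A = begin
  sdet (A +ᴹ I)                                                   ≈⟨ sdet≈invFact·Sdet K cz 𝒜 (A +ᴹ I) ⟩
  invFact n · Sdet (A +ᴹ I)                                       ≈⟨ ·-cong K.refl (Sdet-+ᴹ A I) ⟩
  invFact n · Σ (allSubsets n) (λ S → Sdet (select S A I))        ≈⟨ ·-∑ˡ K cz 𝒜 (invFact n) (allSubsets n) _ ⟩
  Σ (allSubsets n) (λ S → invFact n · Sdet (select S A I))
    ≈⟨ ∑ˡ-cong (allSubsets n) (λ S → invFact-cancel K cz 𝒜 (length (elems S)) n (Sdet-select-1ᴹ A S)) ⟩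
  Σ (allSubsets n) (λ S → invFact (length (elems S)) · Sdet (principal A S))
    ≈⟨ ∑ˡ-cong (allSubsets n) (λ S → sdet≈invFact·Sdet K cz 𝒜 (principal A S)) ⟨
  Σ (allSubsets n) (λ S → sdet (principal A S))                   ∎
  where
  open SDet K cz 𝒜
  open Algebra 𝒜
  open SymmetrizedDeterminant ring using (Sdet; Sdet-+ᴹ; Sdet-select-1ᴹ)
  open CommutativeMonoidSums +-commutativeMonoid using (∑ˡ-cong)
  open import Relation.Binary.Reasoning.Setoid setoid
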